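{- Let $R$ be a positive integer and let $(a_i/b_i)_{i\in\mathcal{I}}$ be a path in $\mathscr{F}_R$ with itinerary $(\lambda_i)_{i\in\mathcal{I}^*}$. Then $(\lambda_i)_{i\in\mathcal{I}^*}$ is the unique sequence of rationals $(\mu_i)_{i\in\mathcal{I}^*}$ satisfying \[ a_{i-1}+a_{i+1}=\mu_ia_i\quad\text{and}\quad b_{i-1}+b_{i+1}=\mu_ib_i\qquad\text{for all }i\in\mathcal{I}^*. \]
   Context: $\mathcal{I}$ is a set of consecutive integers of length at least 3 (possibly infinite) containing $0,1$; $\mathcal{I}'$ is $\mathcal{I}$ minus its least element (if any) and $\mathcal{I}^*$ is $\mathcal{I}'$ minus its greatest element (if any). $\mathscr{F}_R$ is the directed graph with vertices $(a,b)\in\mathbb{Z}^2\setminus\{(0,0)\}$ with $\gcd(a,b)\mid R$, written $a/b$, and an edge $a/b\to c/d$ iff $ad-bc=R$. A path is $(a_i/b_i)_{i\in\mathcal{I}}$ with $a_{i-1}b_i-b_{i-1}a_i=R$ for $i\in\mathcal{I}'$. Its itinerary is $\lambda_i=\frac1R(a_{i-1}b_{i+1}-b_{i-1}a_{i+1})$ for $i\in\mathcal{I}^*$. -}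

module Defs where

open import Data.Nat using (ℕ; NonZero)
open import Data.Integer using (ℤ; +_; _+_; _-_; _*_; _≤_; 0ℤ; 1ℤ)
open import Data.Integer.Divisibility using (_∣_)
open import Data.Integer.GCD using (gcd)
open import Data.Maybe using (Maybe; just; nothing)
open import Data.Product using (_×_)
open import Data.Unit using (⊤)
open import Data.Rational using (ℚ; _/_)
import Data.Rational as Q
open import Relation.Binary.PropositionalEquality using (_≡_)
open import Relation.Nullary using (¬_)

-- A set of consecutive integers, given by an optional least element
-- (nothing = unbounded below) and an optional greatest element
-- (nothing = unbounded above).
record Interval : Set where
  constructor interval
  field
    lo : Maybe ℤ
    hi : Maybe ℤ
open Interval public

AboveLo : Maybe ℤ → ℤ → Set
AboveLo nothing  i = ⊤
AboveLo (just l) i = l ≤ i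

BelowHi : Maybe ℤ → ℤ → Set
BelowHi nothing  i = ⊤
BelowHi (just h) i = i ≤ h

_∈I_ : ℤ → Interval → Set
i ∈I I = AboveLo (lo I) i × BelowHi (hi I) i

LengthAtLeast3 : Interval → Set
LengthAtLeast3 (interval (just l) (just h)) = l + + 2 ≤ h
LengthAtLeast3 (interval _ _) = ⊤

ValidIndexSet : Interval → Set
ValidIndexSet I = LengthAtLeast3 I × (0ℤ ∈I I) × (1ℤ ∈I I)

-- 𝓘' = 𝓘 minus its least element:  i ∈ 𝓘'  iff  i ∈ 𝓘 and i-1 ∈ 𝓘
_∈I'_ : ℤ → Interval → Set
i ∈I' I = (i ∈I I) × ((i - 1ℤ) ∈I I)

-- 𝓘* = 𝓘' minus its greatest element:  i-1, i, i+1 ∈ 𝓘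
_∈I*_ : ℤ → Interval → Set
i ∈I* I = ((i - 1ℤ) ∈I I) × (i ∈I I) × ((i + 1ℤ) ∈I I)

IsVertex : ℕ → ℤ → ℤ → Set
IsVertex R a b = ¬ (a ≡ 0ℤ × b ≡ 0ℤ) × (gcd a b ∣ + R)

-- (a_i/b_i)_{i∈𝓘} is a path in 𝓕_R (values outside 𝓘 are irrelevant)
IsPath : ℕ → Interval → (ℤ → ℤ) → (ℤ → ℤ) → Set
IsPath R I a b =
  (∀ i → i ∈I I → IsVertex R (a i) (b i)) ×
  (∀ i → i ∈I' I → a (i - 1ℤ) * b i - b (i - 1ℤ) * a i ≡ + R)

toℚ : ℤ → ℚ
toℚ n = n / 1

itinerary : (R : ℕ) → .{{NonZero R}} → (ℤ → ℤ) → (ℤ → ℤ) → ℤ → ℚ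
itinerary R a b i = (a (i - 1ℤ) * b (i + 1ℤ) - b (i - 1ℤ) * a (i + 1ℤ)) / R

SatisfiesRecurrence : Interval → (ℤ → ℤ) → (ℤ → ℤ) → (ℤ → ℚ) → Set
SatisfiesRecurrence I a b μ = ∀ i → i ∈I* I →
  (toℚ (a (i - 1ℤ) + a (i + 1ℤ)) ≡ μ i Q.* toℚ (a i)) ×
  (toℚ (b (i - 1ℤ) + b (i + 1ℤ)) ≡ μ i Q.* toℚ (b i))

-- Write A = (x, y), B = (u, v), C = (p, q) for three consecutive vertices of
-- the path, so det(A, B) = det(B, C) = R.  Any three vectors of the plane
-- satisfy det(B, C) A + det(A, B) C = det(A, C) B, which here reads
-- R (A + C) = det(A, C) B: the itinerary λ = det(A, C) / R satisfies both
-- recurrences.  Conversely, B ≠ 0, so μ B = λ B forces μ = λ.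
module Submission where

open import Defs
open import Algebra.Properties.Monoid using (cancelʳ)
open import Data.Integer using (ℤ; +_; _+_; _-_; _*_; 0ℤ; 1ℤ; _≟_)
open import Data.Integer.Properties using (*-distribˡ-+; *-identityʳ; *-comm)
open import Data.Integer.Tactic.RingSolver using (solve-∀)
open import Data.Nat using (ℕ; NonZero; suc)
open import Data.Product using (_×_; _,_; proj₁; proj₂)
open import Data.Rational using (ℚ; _/_; 1/_; fromℚᵘ)
import Data.Rational as ℚ
open import Data.Rational.Properties
  using (toℚᵘ-injective; toℚᵘ-fromℚᵘ; toℚᵘ-homo-*; fromℚᵘ-cong; fromℚᵘ-injective;
         *-inverseʳ; *-1-monoid)
open import Data.Rational.Unnormalised using (mkℚᵘ; *≡*)
import Data.Rational.Unnormalised as ℚᵘ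
open import Data.Rational.Unnormalised.Properties using (≃-trans; ≃-sym; *-cong)
open import Relation.Binary.PropositionalEquality
open import Relation.Nullary using (¬_; yes; no; contradiction)

open ≡-Reasoning

det : ℤ → ℤ → ℤ → ℤ → ℤ
det x y u v = x * v - y * u

det-dependence₁ : ∀ x y u v p q → det u v p q * x + det x y u v * p ≡ det x y p q * u
det-dependence₁ = expanded
  where
  expanded : ∀ x y u v p q → (u * q - v * p) * x + (x * v - y * u) * p ≡ (x * q - y * p) * u
  expanded = solve-∀

det-dependence₂ : ∀ x y u v p q → det u v p q * y + det x y u v * q ≡ det x y p q * v
det-dependence₂ = expanded
  where
  expanded : ∀ x y u v p q → (u * q - v * p) * y + (x * v - y * u) * q ≡ (x * q - y * p) * v
  expanded = solve-∀

fromℚᵘ-homo-* : ∀ p q → fromℚᵘ (p ℚᵘ.* q) ≡ fromℚᵘ p ℚ.* fromℚᵘ q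
fromℚᵘ-homo-* p q = toℚᵘ-injective (≃-trans (toℚᵘ-fromℚᵘ (p ℚᵘ.* q)) (≃-sym
  (≃-trans (toℚᵘ-homo-* (fromℚᵘ p) (fromℚᵘ q)) (*-cong (toℚᵘ-fromℚᵘ p) (toℚᵘ-fromℚᵘ q)))))

-- toℚ s and n / suc k are fromℚᵘ (mkℚᵘ s 0) and fromℚᵘ (mkℚᵘ n k) by definition.
d*s≡n*u⇒s≡n/d*u : ∀ {s n u} d .{{_ : NonZero d}} → + d * s ≡ n * u → toℚ s ≡ (n / d) ℚ.* toℚ u
d*s≡n*u⇒s≡n/d*u {s} {n} {u} (suc k) d*s≡n*u = begin
  toℚ s                              ≡⟨ fromℚᵘ-cong {mkℚᵘ s 0} {n/d*u} (*≡* cross-multiplied) ⟩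
  fromℚᵘ n/d*u                       ≡⟨ fromℚᵘ-homo-* (mkℚᵘ n k) (mkℚᵘ u 0) ⟩
  (n / suc k) ℚ.* toℚ u              ∎
  where
  n/d*u : ℚᵘ.ℚᵘ
  n/d*u = mkℚᵘ n k ℚᵘ.* mkℚᵘ u 0

  cross-multiplied : s * (+ suc k * + 1) ≡ n * u * + 1
  cross-multiplied = begin
    s * (+ suc k * + 1)  ≡⟨ cong (s *_) (*-identityʳ (+ suc k)) ⟩
    s * + suc k          ≡⟨ *-comm s (+ suc k) ⟩
    + suc k * s          ≡⟨ d*s≡n*u ⟩
    n * u                ≡⟨ *-identityʳ (n * u) ⟨
    n * u * + 1          ∎

module NeighbourSums {d} .{{_ : NonZero d}} (x y u v p q : ℤ)
  (det₁≡d : det x y u v ≡ + d) (det₂≡d : det u v p q ≡ + d) where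

  private
    d*-sum : ∀ s t {w} → det u v p q * s + det x y u v * t ≡ w → + d * (s + t) ≡ w
    d*-sum s t {w} dependence = begin
      + d * (s + t)                        ≡⟨ *-distribˡ-+ (+ d) s t ⟩
      + d * s + + d * t                    ≡⟨ cong₂ (λ c c′ → c * s + c′ * t) (sym det₂≡d) (sym det₁≡d) ⟩
      det u v p q * s + det x y u v * t    ≡⟨ dependence ⟩
      w                                    ∎

  neighbour-sum₁ : toℚ (x + p) ≡ (det x y p q / d) ℚ.* toℚ u
  neighbour-sum₁ = d*s≡n*u⇒s≡n/d*u {x + p} {det x y p q} {u} d
    (d*-sum x p (det-dependence₁ x y u v p q))

  neighbour-sum₂ : toℚ (y + q) ≡ (det x y p q / d) ℚ.* toℚ v
  neighbour-sum₂ = d*s≡n*u⇒s≡n/d*u {y + q} {det x y p q} {v} d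
    (d*-sum y q (det-dependence₂ x y u v p q))

toℚ-injective : ∀ {u v} → toℚ u ≡ toℚ v → u ≡ v
toℚ-injective {u} {v} eq with fromℚᵘ-injective {mkℚᵘ u 0} {mkℚᵘ v 0} eq
... | *≡* u*1≡v*1 = begin
  u        ≡⟨ *-identityʳ u ⟨
  u * + 1  ≡⟨ u*1≡v*1 ⟩
  v * + 1  ≡⟨ *-identityʳ v ⟩
  v        ∎

*-cancelʳ-≡ : ∀ {m l} r .{{_ : ℚ.NonZero r}} → m ℚ.* r ≡ l ℚ.* r → m ≡ l
*-cancelʳ-≡ {m} {l} r m*r≡l*r = begin
  m                    ≡⟨ cancelʳ *-1-monoid (*-inverseʳ r) m ⟨
  m ℚ.* r ℚ.* 1/ r     ≡⟨ cong (ℚ._* 1/ r) m*r≡l*r ⟩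
  l ℚ.* r ℚ.* 1/ r     ≡⟨ cancelʳ *-1-monoid (*-inverseʳ r) l ⟩
  l                    ∎

*-cancelʳ-toℚ : ∀ {m l u} → ¬ u ≡ 0ℤ → m ℚ.* toℚ u ≡ l ℚ.* toℚ u → m ≡ l
*-cancelʳ-toℚ {u = u} u≢0 = *-cancelʳ-≡ (toℚ u) {{ℚ.≢-nonZero (λ u≡0 → u≢0 (toℚ-injective u≡0))}}

*-cancelʳ-toℚ² : ∀ {m l u v} → ¬ (u ≡ 0ℤ × v ≡ 0ℤ) →
  m ℚ.* toℚ u ≡ l ℚ.* toℚ u → m ℚ.* toℚ v ≡ l ℚ.* toℚ v → m ≡ l
*-cancelʳ-toℚ² {u = u} {v} uv≢0 eq₁ eq₂ with u ≟ 0ℤ | v ≟ 0ℤ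
... | no u≢0  | _       = *-cancelʳ-toℚ u≢0 eq₁
... | yes _   | no v≢0  = *-cancelʳ-toℚ v≢0 eq₂
... | yes u≡0 | yes v≡0 = contradiction (u≡0 , v≡0) uv≢0

module _ {R} .{{_ : NonZero R}} {I a b} (path : IsPath R I a b) {i} (i∈I* : i ∈I* I) where

  edge-into : det (a (i - 1ℤ)) (b (i - 1ℤ)) (a i) (b i) ≡ + R
  edge-into = proj₂ path i (proj₁ (proj₂ i∈I*) , proj₁ i∈I*)

  edge-out : det (a i) (b i) (a (i + 1ℤ)) (b (i + 1ℤ)) ≡ + R
  edge-out = subst (λ j → det (a j) (b j) (a (i + 1ℤ)) (b (i + 1ℤ)) ≡ + R) (j+1-1≡j i)
    (proj₂ path (i + 1ℤ) (proj₂ (proj₂ i∈I*) , subst (_∈I I) (sym (j+1-1≡j i)) (proj₁ (proj₂ i∈I*))))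
    where
    j+1-1≡j : ∀ j → j + 1ℤ - 1ℤ ≡ j
    j+1-1≡j = solve-∀

  open NeighbourSums (a (i - 1ℤ)) (b (i - 1ℤ)) (a i) (b i) (a (i + 1ℤ)) (b (i + 1ℤ)) edge-into edge-out

  itinerary-recurrence :
    toℚ (a (i - 1ℤ) + a (i + 1ℤ)) ≡ itinerary R a b i ℚ.* toℚ (a i) ×
    toℚ (b (i - 1ℤ) + b (i + 1ℤ)) ≡ itinerary R a b i ℚ.* toℚ (b i)
  itinerary-recurrence = neighbour-sum₁ , neighbour-sum₂

lemma2p2 : (R : ℕ) .{{_ : NonZero R}} (I : Interval) → ValidIndexSet I →
    (a b : ℤ → ℤ) → IsPath R I a b →
    SatisfiesRecurrence I a b (itinerary R a b) ×
    (∀ (μ : ℤ → ℚ) → SatisfiesRecurrence I a b μ →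
      ∀ i → i ∈I* I → μ i ≡ itinerary R a b i)
lemma2p2 R I _ a b path = recurrence , unique
  where
  recurrence : SatisfiesRecurrence I a b (itinerary R a b)
  recurrence i = itinerary-recurrence path

  unique : ∀ μ → SatisfiesRecurrence I a b μ → ∀ i → i ∈I* I → μ i ≡ itinerary R a b i
  unique μ μ-recurrence i i∈I* = *-cancelʳ-toℚ² (proj₁ (proj₁ path i (proj₁ (proj₂ i∈I*))))
    (trans (sym (proj₁ (μ-recurrence i i∈I*))) (proj₁ (recurrence i i∈I*)))
    (trans (sym (proj₂ (μ-recurrence i i∈I*))) (proj₂ (recurrence i i∈I*)))
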